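{- Let $n\ge1$ and $m_1,\dots,m_n\ge2$. In Algorithm WORK-AHEAD (described in the context), whenever the main loop removes an element from the queue $Q$, the queue $Q$ is not empty.
   Context: Algorithm WORK-AHEAD (mixed-radix Gray code generation). Variables: $a_1,\dots,a_n$ all initially $0$; $d_1,\dots,d_n$ all initially $1$; $b_1,\dots,b_{n+1}$ all initially $0$, with an extra radix $m_{n+1}:=2$; a FIFO queue $Q$ of capacity $B:=\lceil n/2\rceil$, initially empty; an integer $j:=1$. Procedure STEP: if $b_j=m_j-1$, set $b_j:=0$ and $j:=j+1$; otherwise, if $Q$ currently holds fewer than $B$ entries, set $b_j:=b_j+1$, append $j$ to the back of $Q$, and set $j:=1$ (if $Q$ holds $B$ entries, STEP does nothing). Main loop, repeated: output the tuple $(a_n,\dots,a_1)$; call STEP; call STEP; remove the front entry $h$ of $Q$; if $h=n+1$, terminate; set $a_h:=a_h+d_h$; if $a_h=0$ or $a_h=m_h-1$, set $d_h:=-d_h$. -}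

module Defs where

open import Data.Nat using (ℕ; zero; suc; _+_; _∸_; _<ᵇ_; _≤ᵇ_; _≡ᵇ_; ⌈_/2⌉)
open import Data.Integer as ℤ using (ℤ; +_; -_)
open import Data.Bool using (Bool; true; false; if_then_else_; _∨_)
open import Data.List using (List; []; _∷_; _++_; [_]; length)
open import Relation.Nullary.Decidable using (⌊_⌋)
open import Data.Maybe using (Maybe; just; nothing; _>>=_)

-- State of Algorithm WORK-AHEAD.  Indices are natural numbers (1-based as in
-- the paper); a, d are indexed by 1..n, b by 1..n+1.
record State : Set where
  constructor st
  field
    a : ℕ → ℤ
    d : ℕ → ℤ
    b : ℕ → ℕ
    Q : List ℕ
    j : ℕ
open State public

upd : {A : Set} → (ℕ → A) → ℕ → A → ℕ → A
upd f i x k = if k ≡ᵇ i then x else f k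

module WorkAhead (n : ℕ) (m : ℕ → ℕ) where

  -- extended radix: m_i for 1 ≤ i ≤ n, and m_{n+1} := 2
  -- (values at indices > n+1 are never consulted by the algorithm)
  M : ℕ → ℕ
  M i = if i ≤ᵇ n then m i else 2

  B : ℕ
  B = ⌈ n /2⌉

  initial : State
  initial = st (λ _ → + 0) (λ _ → + 1) (λ _ → 0) [] 1

  step : State → State
  step s =
    if b s (j s) ≡ᵇ (M (j s) ∸ 1)
    then record s { b = upd (b s) (j s) 0 ; j = suc (j s) }
    else (if length (Q s) <ᵇ B
          then record s { b = upd (b s) (j s) (suc (b s (j s)))
                        ; Q = Q s ++ [ j s ]
                        ; j = 1 }
          else s)

  move : ℕ → State → State
  move h s =
    let ah = a s h ℤ.+ d s h
        flip = ⌊ ah ℤ.≟ + 0 ⌋ ∨ ⌊ ah ℤ.≟ (+ m h ℤ.- + 1) ⌋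
    in record s { a = upd (a s) h ah
                ; d = if flip then upd (d s) h (- d s h) else d s }

  -- If Q is empty at the removal the algorithm is
  -- ill-defined; we return nothing there (the theorem excludes this case).
  iteration : State → Maybe State
  iteration s with step (step s)
  ... | s' with Q s'
  ...   | [] = nothing
  ...   | h ∷ rest =
          if h ≡ᵇ suc n then nothing
          else just (move h (record s' { Q = rest }))

  reach : ℕ → Maybe State
  reach zero = just initial
  reach (suc k) = reach k >>= iteration

  queueAtRemoval : State → List ℕ
  queueAtRemoval s = Q (step (step s))

-- Along the run Z + d ≤ 2|Q| + 1, where Z is the number of maximal digits
-- b_k = m_k - 1 with j ≤ k ≤ n and d counts the STEPs already made in the
-- current pass. A carry lowers Z by one; a push raises Z by at most one and |Q|
-- by one; a STEP that does nothing happens only when |Q| = B and b_j is not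
-- maximal, and then Z < n ≤ 2B = 2|Q| is already the bound for d = 2. So at the
-- removal 2 ≤ 2|Q| + 1, i.e. Q is non-empty, and the removal restores the bound
-- for d = 0. That j never passes n + 1 needs a second invariant: a carry at
-- n + 1 needs b_{n+1} ≠ 0, so n + 1 is in Q, and each of the n digits below it
-- that had to become maximal since then queued an entry behind it: more than
-- B ≤ n entries.
module Submission where

open import Defs
open import Data.Nat using (ℕ; _≤_)
open import Data.List using (List; [])
open import Data.Maybe using (just)
open import Relation.Binary.PropositionalEquality using (_≡_; _≢_)

open import Data.Bool using (Bool; true; false; not; if_then_else_; T)
open import Data.Bool.Properties using (T-≡)
open import Data.Empty using (⊥-elim)
open import Data.List using (_∷_; _++_; [_]; length)
open import Data.List.Properties using (length-++; ++-assoc; ∷-injectiveˡ; ∷-injectiveʳ)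
open import Data.Nat
  using ( zero; suc; _+_; _*_; _∸_; _<_; _≤′_; ≤′-refl; ≤′-step; _≡ᵇ_; _<ᵇ_; _≤ᵇ_
        ; z≤n; s≤s; ⌈_/2⌉; ⌊_/2⌋)
open import Data.Nat.Properties
open import Data.Product using (∃₂; _×_; _,_; proj₂)
open import Data.Sum using (inj₁; inj₂)
open import Function.Bundles using (Equivalence)
open import Relation.Nullary using (¬_)
open import Relation.Binary.PropositionalEquality
  using (refl; sym; trans; cong; subst; module ≡-Reasoning)

private
  T-from : ∀ {x} → x ≡ true → T x
  T-from = Equivalence.from T-≡

upd-updates : ∀ {A : Set} (f : ℕ → A) i x → upd f i x i ≡ x
upd-updates f i x with i ≡ᵇ i in i≡ᵇi
... | true  = refl
... | false = ⊥-elim (subst T i≡ᵇi (≡⇒≡ᵇ i i refl))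

upd-minimal : ∀ {A : Set} (f : ℕ → A) {i x k} → k ≢ i → upd f i x k ≡ f k
upd-minimal f {i} {k = k} k≢i with k ≡ᵇ i in k≡ᵇi
... | true  = ⊥-elim (k≢i (≡ᵇ⇒≡ k i (T-from k≡ᵇi)))
... | false = refl

length-∷ʳ : ∀ {A : Set} (xs : List A) x → length (xs ++ [ x ]) ≡ suc (length xs)
length-∷ʳ xs x = trans (length-++ xs) (+-comm (length xs) 1)

n≤2*⌈n/2⌉ : ∀ n → n ≤ 2 * ⌈ n /2⌉
n≤2*⌈n/2⌉ n = begin
  n                       ≡⟨ sym (⌊n/2⌋+⌈n/2⌉≡n n) ⟩
  ⌊ n /2⌋ + ⌈ n /2⌉       ≤⟨ +-monoˡ-≤ ⌈ n /2⌉ (⌊n/2⌋≤⌈n/2⌉ n) ⟩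
  ⌈ n /2⌉ + ⌈ n /2⌉       ≡⟨ cong (⌈ n /2⌉ +_) (sym (+-identityʳ ⌈ n /2⌉)) ⟩
  2 * ⌈ n /2⌉             ∎
  where open ≤-Reasoning

count : (ℕ → Bool) → ℕ → ℕ → ℕ
count P i zero    = 0
count P i (suc L) = if P i then suc (count P (suc i) L) else count P (suc i) L

count-cong : ∀ {P P' i} L → (∀ {k} → i ≤ k → P k ≡ P' k) → count P i L ≡ count P' i L
count-cong zero    P≗P' = refl
count-cong {P' = P'} {i} (suc L) P≗P' rewrite P≗P' (≤-refl {i}) =
  cong (λ c → if P' i then suc c else c) (count-cong L (λ i<k → P≗P' (<⇒≤ i<k)))

count-≤ : ∀ P i L → count P i L ≤ L
count-≤ P i zero = z≤n
count-≤ P i (suc L) with P i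
... | true  = s≤s (count-≤ P (suc i) L)
... | false = m≤n⇒m≤1+n (count-≤ P (suc i) L)

count-≤-suc-count : ∀ {P P' i} L → (∀ {k} → i < k → P' k ≡ P k) →
                    count P' i L ≤ suc (count P i L)
count-≤-suc-count zero    _     = z≤n
count-≤-suc-count {P} {P'} {i} (suc L) agree
  rewrite count-cong {P'} {P} {suc i} L agree with P' i | P i
... | true  | true  = n≤1+n _
... | true  | false = ≤-refl
... | false | true  = ≤-trans (n≤1+n _) (n≤1+n _)
... | false | false = n≤1+n _

module CountUpTo (n : ℕ) where

  countFrom : (ℕ → Bool) → ℕ → ℕ
  countFrom P i = count P i (suc n ∸ i)

  countFrom-1+n : ∀ P → countFrom P (suc n) ≡ 0
  countFrom-1+n P = cong (count P (suc n)) (n∸n≡0 n)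

  countFrom-true-head : ∀ P {i} → i ≤ n → P i ≡ true → countFrom P i ≡ suc (countFrom P (suc i))
  countFrom-true-head P {i} i≤n Pi = trans (cong (count P i) (+-∸-assoc 1 i≤n))
    (cong (λ x → if x then suc (countFrom P (suc i)) else countFrom P (suc i)) Pi)

  countFrom-false-head : ∀ P {i} → i ≤ n → P i ≡ false → countFrom P i ≡ countFrom P (suc i)
  countFrom-false-head P {i} i≤n Pi = trans (cong (count P i) (+-∸-assoc 1 i≤n))
    (cong (λ x → if x then suc (countFrom P (suc i)) else countFrom P (suc i)) Pi)

  countFrom-skip : ∀ P {i j} → i ≤ j → j ≤ suc n → (∀ {k} → i ≤ k → k < j → P k ≡ false) →
                   countFrom P i ≡ countFrom P j
  countFrom-skip P {i} i≤j = go (≤⇒≤′ i≤j)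
    where
    go : ∀ {j} → i ≤′ j → j ≤ suc n → (∀ {k} → i ≤ k → k < j → P k ≡ false) →
         countFrom P i ≡ countFrom P j
    go ≤′-refl _ _ = refl
    go {suc j} (≤′-step i≤′j) j<1+n false-below = trans
      (go i≤′j (<⇒≤ j<1+n) (λ i≤k k<j → false-below i≤k (m<n⇒m<1+n k<j)))
      (countFrom-false-head P (≤-pred j<1+n) (false-below (≤′⇒≤ i≤′j) ≤-refl))

module Invariants (n : ℕ) (m : ℕ → ℕ) (1≤n : 1 ≤ n) (m≥2 : ∀ i → 1 ≤ i → i ≤ n → 2 ≤ m i) where
  open WorkAhead n m
  open CountUpTo n

  M≥2 : ∀ {k} → 1 ≤ k → 2 ≤ M k
  M≥2 {k} 1≤k with k ≤ᵇ n in k≤ᵇn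
  ... | true  = m≥2 k 1≤k (≤ᵇ⇒≤ k n (T-from k≤ᵇn))
  ... | false = ≤-refl

  digitCount : (ℕ → ℕ → Bool) → State → ℕ
  digitCount p s = countFrom (λ k → p k (b s k)) (j s)

  isMaximal isNonzero : ℕ → ℕ → Bool
  isMaximal k v = v ≡ᵇ M k ∸ 1
  isNonzero k v = not (v ≡ᵇ 0)

  #maximal #nonzero : State → ℕ
  #maximal = digitCount isMaximal
  #nonzero = digitCount isNonzero

  isMaximal-zero : ∀ {k} → 1 ≤ k → isMaximal k 0 ≡ false
  isMaximal-zero {k} 1≤k with M k | M≥2 1≤k
  ... | _ | s≤s (s≤s _) = refl

  isMaximal-positive : ∀ {k v} → 1 ≤ k → isMaximal k v ≡ true → 1 ≤ v
  isMaximal-positive {k} {v} 1≤k maximal =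
    subst (1 ≤_) (sym (≡ᵇ⇒≡ v (M k ∸ 1) (T-from maximal))) (∸-monoˡ-≤ 1 (M≥2 1≤k))

  isNonzero-zero : ∀ {k} → isNonzero k 0 ≡ false
  isNonzero-zero = refl

  isNonzero-positive : ∀ {k v} → 1 ≤ v → isNonzero k v ≡ true
  isNonzero-positive (s≤s _) = refl

  record Invariant (s : State) : Set where
    field
      1≤j          : 1 ≤ j s
      j≤1+n        : j s ≤ suc n
      zero-below-j : ∀ {k} → k < j s → b s k ≡ 0
      |Q|≤B        : length (Q s) ≤ B
      -- The j - 1 digits reset and the #nonzero digits raised since n + 1 was
      -- queued have each queued an entry behind it.
      sentinel     : b s (suc n) ≢ 0 → ∃₂ λ pre post →
                     Q s ≡ pre ++ suc n ∷ post × (j s ∸ 1) + #nonzero s ≤ length post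
  open Invariant

  Potential : ℕ → State → Set
  Potential d s = d + #maximal s ≤ suc (2 * length (Q s))

  carried pushed : State → State
  carried s = record s { b = upd (b s) (j s) 0 ; j = suc (j s) }
  pushed  s = record s { b = upd (b s) (j s) (suc (b s (j s))) ; Q = Q s ++ [ j s ] ; j = 1 }

  data StepView (s : State) : State → Set where
    carry : isMaximal (j s) (b s (j s)) ≡ true → StepView s (carried s)
    push  : length (Q s) < B → StepView s (pushed s)
    stall : isMaximal (j s) (b s (j s)) ≡ false → ¬ length (Q s) < B → StepView s s

  stepView : ∀ s → StepView s (step s)
  stepView s with isMaximal (j s) (b s (j s)) in maximal
  ... | true  = carry maximal
  ... | false with length (Q s) <ᵇ B in fits
  ...   | true  = push (<ᵇ⇒< _ _ (T-from fits))
  ...   | false = stall maximal (λ lt → subst T fits (<⇒<ᵇ lt))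

  carry-within-range : ∀ {s} → Invariant s → isMaximal (j s) (b s (j s)) ≡ true → j s ≤ n
  carry-within-range {s} I maximal with m≤n⇒m<n∨m≡n (j≤1+n I)
  ... | inj₁ j<1+n = ≤-pred j<1+n
  ... | inj₂ j≡1+n
    with sentinel I (m<n⇒n≢0 (isMaximal-positive (s≤s z≤n)
                      (subst (λ i → isMaximal i (b s i) ≡ true) j≡1+n maximal)))
  ...   | pre , post , Q≡ , behind = ⊥-elim (<-irrefl refl n<n)
    where
    open ≤-Reasoning
    n<n : n < n
    n<n = begin-strict
      n                                  ≡⟨ cong (_∸ 1) (sym j≡1+n) ⟩
      j s ∸ 1                            ≤⟨ m≤m+n _ _ ⟩
      (j s ∸ 1) + #nonzero s             ≤⟨ behind ⟩
      length post                        <⟨ m≤n+m _ (length pre) ⟩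
      length pre + length (suc n ∷ post) ≡⟨ sym (length-++ pre) ⟩
      length (pre ++ suc n ∷ post)       ≡⟨ cong length (sym Q≡) ⟩
      length (Q s)                       ≤⟨ |Q|≤B I ⟩
      B                                  ≤⟨ ⌈n/2⌉≤n n ⟩
      n                                  ∎

  digitCount-carried : ∀ p s → j s ≤ n → p (j s) (b s (j s)) ≡ true →
                       digitCount p s ≡ suc (digitCount p (carried s))
  digitCount-carried p s j≤n pj = trans (countFrom-true-head _ j≤n pj)
    (cong suc (count-cong (n ∸ j s) (λ j<k → cong (p _) (sym (upd-minimal (b s) (>⇒≢ j<k))))))

  carry-invariant : ∀ {s} → Invariant s → isMaximal (j s) (b s (j s)) ≡ true → Invariant (carried s)
  carry-invariant {s} I maximal = record
    { 1≤j          = s≤s z≤n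
    ; j≤1+n        = s≤s j≤n
    ; zero-below-j = zero-below
    ; |Q|≤B        = |Q|≤B I
    ; sentinel     = sentinel′
    }
    where
    j≤n : j s ≤ n
    j≤n = carry-within-range I maximal

    zero-below : ∀ {k} → k < suc (j s) → upd (b s) (j s) 0 k ≡ 0
    zero-below k<1+j with m≤n⇒m<n∨m≡n (≤-pred k<1+j)
    ... | inj₁ k<j  = trans (upd-minimal (b s) (<⇒≢ k<j)) (zero-below-j I k<j)
    ... | inj₂ refl = upd-updates (b s) (j s) 0

    nonzero-drops : #nonzero s ≡ suc (#nonzero (carried s))
    nonzero-drops = digitCount-carried isNonzero s j≤n
      (isNonzero-positive {j s} (isMaximal-positive {v = b s (j s)} (1≤j I) maximal))

    behind-invariant : (j s ∸ 1) + #nonzero s ≡ j s + #nonzero (carried s)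
    behind-invariant = begin
      (j s ∸ 1) + #nonzero s                  ≡⟨ cong (j s ∸ 1 +_) nonzero-drops ⟩
      (j s ∸ 1) + suc (#nonzero (carried s))  ≡⟨ +-suc (j s ∸ 1) _ ⟩
      suc (j s ∸ 1) + #nonzero (carried s)    ≡⟨ cong (_+ #nonzero (carried s)) (m+[n∸m]≡n (1≤j I)) ⟩
      j s + #nonzero (carried s)              ∎
      where open ≡-Reasoning

    sentinel′ : upd (b s) (j s) 0 (suc n) ≢ 0 → ∃₂ λ pre post →
                Q s ≡ pre ++ suc n ∷ post × j s + #nonzero (carried s) ≤ length post
    sentinel′ b≢0 with sentinel I (λ b≡0 → b≢0 (trans (upd-minimal (b s) (>⇒≢ (s≤s j≤n))) b≡0))
    ... | pre , post , Q≡ , behind = pre , post , Q≡ , subst (_≤ length post) behind-invariant behind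

  carry-potential : ∀ {d s} → Invariant s → isMaximal (j s) (b s (j s)) ≡ true →
                    Potential d s → Potential (suc d) (carried s)
  carry-potential {d} {s} I maximal P = begin
    suc d + #maximal (carried s)    ≡⟨ sym (+-suc d _) ⟩
    d + suc (#maximal (carried s))  ≡⟨ cong (d +_) (sym (digitCount-carried isMaximal s
                                                          (carry-within-range I maximal) maximal)) ⟩
    d + #maximal s                  ≤⟨ P ⟩
    suc (2 * length (Q s))          ∎
    where open ≤-Reasoning

  digitCount-pushed : ∀ p {s} → Invariant s → (∀ {k} → 1 ≤ k → p k 0 ≡ false) →
                      digitCount p (pushed s) ≡ countFrom (λ k → p k (b (pushed s) k)) (j s)
  digitCount-pushed p {s} I p-zero = countFrom-skip _ (1≤j I) (j≤1+n I) λ 1≤k k<j →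
    trans (cong (p _) (trans (upd-minimal (b s) (<⇒≢ k<j)) (zero-below-j I k<j))) (p-zero 1≤k)

  digitCount-pushed-≤ : ∀ p {s} → Invariant s → (∀ {k} → 1 ≤ k → p k 0 ≡ false) →
                        digitCount p (pushed s) ≤ suc (digitCount p s)
  digitCount-pushed-≤ p {s} I p-zero = begin
    digitCount p (pushed s)                           ≡⟨ digitCount-pushed p I p-zero ⟩
    countFrom (λ k → p k (b (pushed s) k)) (j s)      ≤⟨ count-≤-suc-count (suc n ∸ j s)
                                                           (λ j<k → cong (p _) (upd-minimal (b s) (>⇒≢ j<k))) ⟩
    suc (digitCount p s)                              ∎
    where open ≤-Reasoning

  push-invariant : ∀ {s} → Invariant s → length (Q s) < B → Invariant (pushed s)
  push-invariant {s} I fits = record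
    { 1≤j          = s≤s z≤n
    ; j≤1+n        = s≤s z≤n
    ; zero-below-j = λ { (s≤s z≤n) → trans (upd-minimal (b s) (<⇒≢ (1≤j I))) (zero-below-j I (1≤j I)) }
    ; |Q|≤B        = subst (_≤ B) (sym (length-∷ʳ (Q s) (j s))) fits
    ; sentinel     = sentinel′
    }
    where
    open ≤-Reasoning
    sentinel′ : b (pushed s) (suc n) ≢ 0 → ∃₂ λ pre post →
                Q s ++ [ j s ] ≡ pre ++ suc n ∷ post × #nonzero (pushed s) ≤ length post
    sentinel′ b≢0 with m≤n⇒m<n∨m≡n (j≤1+n I)
    ... | inj₂ j≡1+n = Q s , [] , cong (λ x → Q s ++ [ x ]) j≡1+n , ≤-reflexive (begin-equality
      #nonzero (pushed s)                                    ≡⟨ digitCount-pushed isNonzero I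
                                                                  (λ {k} _ → isNonzero-zero {k}) ⟩
      countFrom (λ k → isNonzero k (b (pushed s) k)) (j s)   ≡⟨ cong (countFrom _) j≡1+n ⟩
      countFrom (λ k → isNonzero k (b (pushed s) k)) (suc n) ≡⟨ countFrom-1+n _ ⟩
      0                                                      ∎)
    ... | inj₁ j<1+n with sentinel I (λ b≡0 → b≢0 (trans (upd-minimal (b s) (>⇒≢ j<1+n)) b≡0))
    ...   | pre , post , Q≡ , behind =
      pre , post ++ [ j s ] , trans (cong (_++ [ j s ]) Q≡) (++-assoc pre (suc n ∷ post) [ j s ]) , (begin
        #nonzero (pushed s)             ≤⟨ digitCount-pushed-≤ isNonzero I (λ {k} _ → isNonzero-zero {k}) ⟩
        suc (#nonzero s)                ≤⟨ s≤s (m≤n+m _ (j s ∸ 1)) ⟩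
        suc ((j s ∸ 1) + #nonzero s)    ≤⟨ s≤s behind ⟩
        suc (length post)               ≡⟨ sym (length-∷ʳ post (j s)) ⟩
        length (post ++ [ j s ])        ∎)

  push-potential : ∀ {d s} → Invariant s → Potential d s → Potential (suc d) (pushed s)
  push-potential {d} {s} I P = begin
    suc d + #maximal (pushed s)          ≤⟨ +-monoʳ-≤ (suc d) (digitCount-pushed-≤ isMaximal I isMaximal-zero) ⟩
    suc d + suc (#maximal s)             ≡⟨ cong suc (+-suc d _) ⟩
    suc (suc (d + #maximal s))           ≤⟨ s≤s (s≤s P) ⟩
    suc (suc (suc (2 * length (Q s))))   ≡⟨ cong suc (sym (*-suc 2 _)) ⟩
    suc (2 * suc (length (Q s)))         ≡⟨ cong (λ ℓ → suc (2 * ℓ)) (sym (length-∷ʳ (Q s) (j s))) ⟩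
    suc (2 * length (Q (pushed s)))      ∎
    where open ≤-Reasoning

  #maximal<n : ∀ {s} → Invariant s → isMaximal (j s) (b s (j s)) ≡ false → #maximal s < n
  #maximal<n {s} I not-maximal with m≤n⇒m<n∨m≡n (j≤1+n I)
  ... | inj₂ j≡1+n = subst (_< n) (sym (trans (cong (countFrom _) j≡1+n) (countFrom-1+n _))) 1≤n
  ... | inj₁ j<1+n = begin-strict
    #maximal s                                        ≡⟨ countFrom-false-head _ (≤-pred j<1+n) not-maximal ⟩
    countFrom (λ k → isMaximal k (b s k)) (suc (j s)) ≤⟨ count-≤ _ _ _ ⟩
    n ∸ j s                                           <⟨ ∸-monoʳ-< (1≤j I) (≤-pred j<1+n) ⟩
    n                                                 ∎
    where open ≤-Reasoning

  stall-potential : ∀ {s} → Invariant s → isMaximal (j s) (b s (j s)) ≡ false → ¬ length (Q s) < B →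
                    Potential 2 s
  stall-potential {s} I not-maximal full = begin
    2 + #maximal s          ≤⟨ s≤s (#maximal<n I not-maximal) ⟩
    suc n                   ≤⟨ s≤s (n≤2*⌈n/2⌉ n) ⟩
    suc (2 * B)             ≡⟨ cong (λ ℓ → suc (2 * ℓ)) (sym (≤-antisym (|Q|≤B I) (≮⇒≥ full))) ⟩
    suc (2 * length (Q s))  ∎
    where open ≤-Reasoning

  step-preserves : ∀ {d s} → d ≤ 1 → Invariant s → Potential d s →
                   Invariant (step s) × Potential (suc d) (step s)
  step-preserves {s = s} d≤1 I P with step s | stepView s
  ... | _ | carry maximal          = carry-invariant I maximal , carry-potential I maximal P
  ... | _ | push fits              = push-invariant I fits , push-potential I P
  ... | _ | stall not-maximal full =
    I , ≤-trans (+-monoˡ-≤ (#maximal s) (s≤s d≤1)) (stall-potential I not-maximal full)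

  two-steps-preserve : ∀ {s} → Invariant s → Potential 0 s →
                       Invariant (step (step s)) × Potential 2 (step (step s))
  two-steps-preserve I P with step-preserves z≤n I P
  ... | I₁ , P₁ = step-preserves ≤-refl I₁ P₁

  queue-nonempty : ∀ t → Potential 2 t → Q t ≢ []
  queue-nonempty t P Q≡[] with subst (λ q → 2 + #maximal t ≤ suc (2 * length q)) Q≡[] P
  ... | s≤s ()

  iteration-dequeues : ∀ {s s′} → iteration s ≡ just s′ → ∃₂ λ h rest →
    Q (step (step s)) ≡ h ∷ rest × h ≢ suc n × s′ ≡ move h (record (step (step s)) { Q = rest })
  iteration-dequeues {s} eq with step (step s)
  ... | t with Q t
  iteration-dequeues () | t | []
  iteration-dequeues eq | t | h ∷ rest with h ≡ᵇ suc n in h≡ᵇ1+n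
  iteration-dequeues () | t | h ∷ rest | true
  iteration-dequeues refl | t | h ∷ rest | false =
    h , rest , refl , (λ h≡1+n → subst T h≡ᵇ1+n (≡⇒≡ᵇ h (suc n) h≡1+n)) , refl

  dequeue-invariant : ∀ {t h rest} → Invariant t → Q t ≡ h ∷ rest → h ≢ suc n →
                      Invariant (move h (record t { Q = rest }))
  dequeue-invariant {t} {rest = rest} I Q≡ h≢1+n = record
    { 1≤j          = 1≤j I
    ; j≤1+n        = j≤1+n I
    ; zero-below-j = zero-below-j I
    ; |Q|≤B        = ≤-trans (n≤1+n _) (subst (_≤ B) (cong length Q≡) (|Q|≤B I))
    ; sentinel     = sentinel′
    }
    where
    sentinel′ : b t (suc n) ≢ 0 → ∃₂ λ pre post →
                rest ≡ pre ++ suc n ∷ post × (j t ∸ 1) + #nonzero t ≤ length post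
    sentinel′ b≢0 with sentinel I b≢0
    ... | []      , post , Q≡′ , behind = ⊥-elim (h≢1+n (∷-injectiveˡ (trans (sym Q≡) Q≡′)))
    ... | _ ∷ pre , post , Q≡′ , behind = pre , post , ∷-injectiveʳ (trans (sym Q≡) Q≡′) , behind

  dequeue-potential : ∀ t {h rest} → Potential 2 t → Q t ≡ h ∷ rest →
                      Potential 0 (move h (record t { Q = rest }))
  dequeue-potential t {rest = rest} P Q≡ = ≤-pred (≤-pred (begin
    2 + #maximal t                      ≤⟨ P ⟩
    suc (2 * length (Q t))              ≡⟨ cong (λ q → suc (2 * length q)) Q≡ ⟩
    suc (2 * suc (length rest))         ≡⟨ cong suc (*-suc 2 (length rest)) ⟩
    suc (suc (suc (2 * length rest)))   ∎))
    where open ≤-Reasoning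

  iteration-preserves : ∀ {s s′} → Invariant s → Potential 0 s → iteration s ≡ just s′ →
                        Invariant s′ × Potential 0 s′
  iteration-preserves {s} I P eq with two-steps-preserve I P | iteration-dequeues {s} eq
  ... | I₂ , P₂ | h , rest , Q≡ , h≢1+n , refl =
    dequeue-invariant I₂ Q≡ h≢1+n , dequeue-potential (step (step s)) P₂ Q≡

  initial-invariant : Invariant initial
  initial-invariant = record
    { 1≤j = s≤s z≤n ; j≤1+n = s≤s z≤n ; zero-below-j = λ _ → refl
    ; |Q|≤B = z≤n ; sentinel = λ b≢0 → ⊥-elim (b≢0 refl) }

  initial-potential : Potential 0 initial
  initial-potential = ≤-trans (≤-reflexive no-maximal) z≤n
    where
    no-maximal : #maximal initial ≡ 0
    no-maximal = trans (countFrom-skip _ (s≤s z≤n) ≤-refl (λ 1≤k _ → isMaximal-zero 1≤k)) (countFrom-1+n _)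

  reach-invariant : ∀ k {s} → reach k ≡ just s → Invariant s × Potential 0 s
  reach-invariant zero refl = initial-invariant , initial-potential
  reach-invariant (suc k) eq with reach k in reach-k
  ... | just s₀ with reach-invariant k reach-k
  ...   | I , P = iteration-preserves I P eq

lemma2 : (n : ℕ) (m : ℕ → ℕ) → 1 ≤ n → (∀ i → 1 ≤ i → i ≤ n → 2 ≤ m i) →
    ∀ (k : ℕ) (s : State) → WorkAhead.reach n m k ≡ just s →
    WorkAhead.queueAtRemoval n m s ≢ []
lemma2 n m 1≤n m≥2 k s reach-k =
  let I , P = reach-invariant k reach-k
  in  queue-nonempty (step (step s)) (proj₂ (two-steps-preserve I P))
  where
  open WorkAhead n m
  open Invariants n m 1≤n m≥2
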